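{- Let $E$ be an E-context (as defined below). For every $\lambda$-term $t$, $E[t] \to_\beta^* t\{\eta(E)\}$.
   Context: $\lambda$-terms are given by $s,t ::= x \mid \lambda x.t \mid st$, considered modulo $\alpha$-conversion and with all bound variables distinct from each other and from free variables (distinct names convention). $t\{s/x\}$ denotes capture-avoiding substitution of $s$ for the free occurrences of $x$ in $t$; $\to_\beta$ is the usual $\beta$-reduction $(\lambda x.t)s\to_\beta t\{s/x\}$ closed under all contexts, and $\to_\beta^*$ its reflexive-transitive closure. A context is a term with exactly one hole $\square$; $C[t]$ denotes plugging $t$ into the hole without renaming (so variables may be captured). E-contexts are generated by the grammar $E ::= \square \mid E_1[\lambda x.E_2]\,t$, where $E_1,E_2$ are E-contexts and $t$ is a term. An environment is a finite sequence $\eta = t_1/x_1,\ldots,t_k/x_k$, and $t\{\eta\} := t\{t_1/x_1\}\{t_2/x_2\}\cdots\{t_k/x_k\}$ (substitutions applied successively, left to right). The environment of an E-context is defined inductively by $\eta(\square)=\epsilon$ (empty sequence) and $\eta(E_1[\lambda x.E_2]t) = \eta(E_2),\,t/x,\,\eta(E_1)$. -}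

module Defs where

open import Data.Nat using (ℕ; zero; suc)
open import Data.Fin using (Fin; zero; suc)
open import Relation.Binary.Construct.Closure.ReflexiveTransitive using (Star)

-- λ-terms in de Bruijn representation, indexed by the number of free
-- variables in scope (this realises terms modulo α-conversion).
data Term (n : ℕ) : Set where
  var : Fin n → Term n
  lam : Term (suc n) → Term n
  app : Term n → Term n → Term n

ext : ∀ {m n} → (Fin m → Fin n) → Fin (suc m) → Fin (suc n)
ext ρ zero    = zero
ext ρ (suc i) = suc (ρ i)

rename : ∀ {m n} → (Fin m → Fin n) → Term m → Term n
rename ρ (var i)   = var (ρ i)
rename ρ (lam t)   = lam (rename (ext ρ) t)
rename ρ (app s t) = app (rename ρ s) (rename ρ t)

weaken : ∀ {n} → Term n → Term (suc n)
weaken = rename suc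

exts : ∀ {m n} → (Fin m → Term n) → Fin (suc m) → Term (suc n)
exts σ zero    = var zero
exts σ (suc i) = weaken (σ i)

subst : ∀ {m n} → (Fin m → Term n) → Term m → Term n
subst σ (var i)   = σ i
subst σ (lam t)   = lam (subst (exts σ) t)
subst σ (app s t) = app (subst σ s) (subst σ t)

-- single substitution  t{s/x}  where x is the innermost variable (index 0)
σ₀ : ∀ {n} → Term n → Fin (suc n) → Term n
σ₀ s zero    = s
σ₀ s (suc i) = var i

_[_]₀ : ∀ {n} → Term (suc n) → Term n → Term n
t [ s ]₀ = subst (σ₀ s) t

data _→β_ {n : ℕ} : Term n → Term n → Set where
  β    : ∀ {t : Term (suc n)} {s : Term n} → app (lam t) s →β (t [ s ]₀)
  ξlam : ∀ {t t' : Term (suc n)} → t →β t' → lam t →β lam t'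
  ξl   : ∀ {s s' t : Term n} → s →β s' → app s t →β app s' t
  ξr   : ∀ {s t t' : Term n} → t →β t' → app s t →β app s t'

_→β*_ : ∀ {n} → Term n → Term n → Set
_→β*_ = Star _→β_

-- E-contexts  E ::= □ | E₁[λx.E₂] t.
-- ECtx n m : a context which, plugged with a term in scope m (the outer n
-- variables plus the binders on the path to the hole), gives a term in scope n.
data ECtx (n : ℕ) : ℕ → Set where
  □       : ECtx n n
  _[λ_]·_ : ∀ {k m} → ECtx n k → ECtx (suc k) m → Term n → ECtx n m

-- plugging (variables of the plugged term may be captured by binders of E)
plug : ∀ {n m} → ECtx n m → Term m → Term n
plug □               u = u
plug (E₁ [λ E₂ ]· t) u = app (plug E₁ (lam (plug E₂ u))) t

-- a term whose free variables are those of the outside of E, seen at the hole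
-- (no capture: bound variables of E are distinct from free variables)
shift : ∀ {n m} → ECtx n m → Term n → Term m
shift □               u = u
shift (E₁ [λ E₂ ]· t) u = shift E₂ (weaken (shift E₁ u))

-- Environments  t₁/x₁, …, t_k/x_k : each entry substitutes for the innermost
-- remaining variable. Env m n takes terms in scope m to terms in scope n.
data Env : ℕ → ℕ → Set where
  ε   : ∀ {n} → Env n n
  _∷_ : ∀ {k n} → Term k → Env k n → Env (suc k) n

_++_ : ∀ {m k n} → Env m k → Env k n → Env m n
ε       ++ θ = θ
(s ∷ η) ++ θ = s ∷ (η ++ θ)

-- t{η} := t{t₁/x₁}{t₂/x₂}⋯{t_k/x_k}  (left to right)
_⟪_⟫ : ∀ {m n} → Term m → Env m n → Term n
u ⟪ ε ⟫     = u
u ⟪ s ∷ η ⟫ = (u [ s ]₀) ⟪ η ⟫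

env : ∀ {n m} → ECtx n m → Env m n
env □               = ε
env (E₁ [λ E₂ ]· t) = env E₂ ++ (shift E₁ t ∷ env E₁)

-- For E = E₁[λx.E₂]t, reduce inside the hole of E₂ to reach
-- E₁[λx.u{η(E₂)}]t, then inside E₁ to reach (λx.u{η(E₂)}){η(E₁)} t, and
-- contract this redex. Since no binder of E₁ occurs free in t, t = t{η(E₁)},
-- so by the substitution lemma the contractum is u{η(E₂)}{t/x}{η(E₁)}.
module Submission where

open import Defs
open import Data.Nat as ℕ using (ℕ)
open import Data.Fin using (Fin; zero; suc)
open import Function using (_∘_)
open import Relation.Binary.PropositionalEquality as Eq
  using (_≡_; refl; cong; cong₂; sym; trans)
open import Relation.Binary.Construct.Closure.ReflexiveTransitive as Star
  using (ε; _◅_; _◅◅_)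
open Eq.≡-Reasoning

rename-cong : ∀ {m n} {ρ ρ′ : Fin m → Fin n} →
              (∀ i → ρ i ≡ ρ′ i) → ∀ u → rename ρ u ≡ rename ρ′ u
rename-cong h (var i)   = cong var (h i)
rename-cong h (lam u)   = cong lam (rename-cong ext-cong u)
  where
  ext-cong : ∀ i → ext _ i ≡ ext _ i
  ext-cong zero    = refl
  ext-cong (suc i) = cong suc (h i)
rename-cong h (app s t) = cong₂ app (rename-cong h s) (rename-cong h t)

subst-cong : ∀ {m n} {σ τ : Fin m → Term n} →
             (∀ i → σ i ≡ τ i) → ∀ u → subst σ u ≡ subst τ u
subst-cong h (var i)   = h i
subst-cong h (lam u)   = cong lam (subst-cong exts-cong u)
  where
  exts-cong : ∀ i → exts _ i ≡ exts _ i
  exts-cong zero    = refl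
  exts-cong (suc i) = cong weaken (h i)
subst-cong h (app s t) = cong₂ app (subst-cong h s) (subst-cong h t)

rename-rename : ∀ {l m n} (ρ : Fin m → Fin n) (ρ′ : Fin l → Fin m) u →
                rename ρ (rename ρ′ u) ≡ rename (ρ ∘ ρ′) u
rename-rename ρ ρ′ (var i)   = refl
rename-rename ρ ρ′ (lam u)   =
  cong lam (trans (rename-rename (ext ρ) (ext ρ′) u) (rename-cong ext-∘ u))
  where
  ext-∘ : ∀ i → ext ρ (ext ρ′ i) ≡ ext (ρ ∘ ρ′) i
  ext-∘ zero    = refl
  ext-∘ (suc i) = refl
rename-rename ρ ρ′ (app s t) = cong₂ app (rename-rename ρ ρ′ s) (rename-rename ρ ρ′ t)

rename-subst : ∀ {l m n} (ρ : Fin m → Fin n) (σ : Fin l → Term m) u →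
               rename ρ (subst σ u) ≡ subst (rename ρ ∘ σ) u
rename-subst ρ σ (var i)   = refl
rename-subst ρ σ (lam u)   =
  cong lam (trans (rename-subst (ext ρ) (exts σ) u) (subst-cong ext-exts u))
  where
  ext-exts : ∀ i → rename (ext ρ) (exts σ i) ≡ exts (rename ρ ∘ σ) i
  ext-exts zero    = refl
  ext-exts (suc i) = trans (rename-rename (ext ρ) suc (σ i)) (sym (rename-rename suc ρ (σ i)))
rename-subst ρ σ (app s t) = cong₂ app (rename-subst ρ σ s) (rename-subst ρ σ t)

subst-rename : ∀ {l m n} (σ : Fin m → Term n) (ρ : Fin l → Fin m) u →
               subst σ (rename ρ u) ≡ subst (σ ∘ ρ) u
subst-rename σ ρ (var i)   = refl
subst-rename σ ρ (lam u)   =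
  cong lam (trans (subst-rename (exts σ) (ext ρ) u) (subst-cong exts-ext u))
  where
  exts-ext : ∀ i → exts σ (ext ρ i) ≡ exts (σ ∘ ρ) i
  exts-ext zero    = refl
  exts-ext (suc i) = refl
subst-rename σ ρ (app s t) = cong₂ app (subst-rename σ ρ s) (subst-rename σ ρ t)

subst-subst : ∀ {l m n} (τ : Fin m → Term n) (σ : Fin l → Term m) u →
              subst τ (subst σ u) ≡ subst (subst τ ∘ σ) u
subst-subst τ σ (var i)   = refl
subst-subst τ σ (lam u)   =
  cong lam (trans (subst-subst (exts τ) (exts σ) u) (subst-cong exts-exts u))
  where
  exts-exts : ∀ i → subst (exts τ) (exts σ i) ≡ exts (subst τ ∘ σ) i
  exts-exts zero    = refl
  exts-exts (suc i) = trans (subst-rename (exts τ) suc (σ i)) (sym (rename-subst suc τ (σ i)))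
subst-subst τ σ (app s t) = cong₂ app (subst-subst τ σ s) (subst-subst τ σ t)

subst-var : ∀ {n} (u : Term n) → subst var u ≡ u
subst-var (var i)   = refl
subst-var (lam u)   = cong lam (trans (subst-cong exts-var u) (subst-var u))
  where
  exts-var : ∀ i → exts var i ≡ var i
  exts-var zero    = refl
  exts-var (suc i) = refl
subst-var (app s t) = cong₂ app (subst-var s) (subst-var t)

weaken-[]₀ : ∀ {n} (u s : Term n) → weaken u [ s ]₀ ≡ u
weaken-[]₀ u s = trans (subst-rename (σ₀ s) suc u) (subst-var u)

subst-[]₀ : ∀ {m n} (σ : Fin m → Term n) (u : Term (ℕ.suc m)) (s : Term m) →
            subst (exts σ) u [ subst σ s ]₀ ≡ subst σ (u [ s ]₀)
subst-[]₀ σ u s = begin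
    subst (σ₀ (subst σ s)) (subst (exts σ) u)   ≡⟨ subst-subst _ (exts σ) u ⟩
    subst (subst (σ₀ (subst σ s)) ∘ exts σ) u   ≡⟨ subst-cong pointwise u ⟩
    subst (subst σ ∘ σ₀ s) u                    ≡⟨ sym (subst-subst σ (σ₀ s) u) ⟩
    subst σ (u [ s ]₀)                          ∎
  where
  pointwise : ∀ i → subst (σ₀ (subst σ s)) (exts σ i) ≡ subst σ (σ₀ s i)
  pointwise zero    = refl
  pointwise (suc i) = weaken-[]₀ (σ i) (subst σ s)

toSubst : ∀ {m n} → Env m n → Fin m → Term n
toSubst ε       = var
toSubst (s ∷ η) = subst (toSubst η) ∘ σ₀ s

⟪⟫≡subst : ∀ {m n} (u : Term m) (η : Env m n) → u ⟪ η ⟫ ≡ subst (toSubst η) u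
⟪⟫≡subst u ε       = sym (subst-var u)
⟪⟫≡subst u (s ∷ η) = trans (⟪⟫≡subst (u [ s ]₀) η) (subst-subst (toSubst η) (σ₀ s) u)

⟪⟫-++ : ∀ {m k n} (u : Term m) (η : Env m k) (θ : Env k n) →
        u ⟪ η ++ θ ⟫ ≡ u ⟪ η ⟫ ⟪ θ ⟫
⟪⟫-++ u ε       θ = refl
⟪⟫-++ u (s ∷ η) θ = ⟪⟫-++ (u [ s ]₀) η θ

β-⟪⟫ : ∀ {m n} (η : Env m n) (u : Term (ℕ.suc m)) (s : Term m) →
       app (lam u ⟪ η ⟫) (s ⟪ η ⟫) →β ((u [ s ]₀) ⟪ η ⟫)
β-⟪⟫ η u s
  rewrite ⟪⟫≡subst (lam u) η | ⟪⟫≡subst s η | ⟪⟫≡subst (u [ s ]₀) η =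
  Eq.subst (app _ _ →β_) (subst-[]₀ (toSubst η) u s) β

-- The distinct names convention: the binders of E do not occur in u, so the
-- environment of E acts trivially on the shifted u.
shift-⟪env⟫ : ∀ {n m} (E : ECtx n m) (u : Term n) → shift E u ⟪ env E ⟫ ≡ u
shift-⟪env⟫ □               u = refl
shift-⟪env⟫ (E₁ [λ E₂ ]· t) u = begin
    shift E₂ w ⟪ env E₂ ++ (shift E₁ t ∷ env E₁) ⟫    ≡⟨ ⟪⟫-++ (shift E₂ w) (env E₂) _ ⟩
    shift E₂ w ⟪ env E₂ ⟫ ⟪ shift E₁ t ∷ env E₁ ⟫     ≡⟨ cong (_⟪ shift E₁ t ∷ env E₁ ⟫) (shift-⟪env⟫ E₂ w) ⟩
    (w [ shift E₁ t ]₀) ⟪ env E₁ ⟫                    ≡⟨ cong (_⟪ env E₁ ⟫) (weaken-[]₀ (shift E₁ u) _) ⟩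
    shift E₁ u ⟪ env E₁ ⟫                             ≡⟨ shift-⟪env⟫ E₁ u ⟩
    u                                                 ∎
  where w = weaken (shift E₁ u)

plug-→β : ∀ {n m} (E : ECtx n m) {s s′ : Term m} → s →β s′ → plug E s →β plug E s′
plug-→β □               r = r
plug-→β (E₁ [λ E₂ ]· t) r = ξl (plug-→β E₁ (ξlam (plug-→β E₂ r)))

plug-→β* : ∀ {n m} (E : ECtx n m) {s s′ : Term m} → s →β* s′ → plug E s →β* plug E s′
plug-→β* E = Star.gmap (plug E) (plug-→β E)

ξl* : ∀ {n} {s s′ : Term n} (t : Term n) → s →β* s′ → app s t →β* app s′ t
ξl* t = Star.gmap (λ s → app s t) ξl

lemma4 : ∀ {n m : ℕ} (E : ECtx n m) (t : Term m) → plug E t →β* (t ⟪ env E ⟫)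
lemma4 □               u = ε
lemma4 (_[λ_]·_ {k} E₁ E₂ t) u =
  Eq.subst (plug (E₁ [λ E₂ ]· t) u →β*_) (sym (⟪⟫-++ u (env E₂) _))
    (plug-→β* (E₁ [λ □ ]· t) (lemma4 E₂ u)
     ◅◅ ξl* t (lemma4 E₁ (lam Q))
     ◅◅ contract ◅ ε)
  where
  Q : Term (ℕ.suc k)
  Q = u ⟪ env E₂ ⟫
  contract : app (lam Q ⟪ env E₁ ⟫) t →β ((Q [ shift E₁ t ]₀) ⟪ env E₁ ⟫)
  contract = Eq.subst (λ s → app (lam Q ⟪ env E₁ ⟫) s →β ((Q [ shift E₁ t ]₀) ⟪ env E₁ ⟫))
               (shift-⟪env⟫ E₁ t) (β-⟪⟫ (env E₁) Q (shift E₁ t))
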